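{- Let $v\in\mathcal{P}_n$ and suppose $v_{ik}=0$ for some $\{i,k\}\subset[n]$. Then for every $j,l$ such that $i,j,k,l$ are four distinct elements of $[n]$ we have $v_{ij}v_{kl}=v_{il}v_{jk}$.
   Context: $\mathcal{P}_n=\{v\in\mathbb{R}_{\ge0}^{\binom n2}: v_{ij}v_{kl}\le v_{ik}v_{jl}+v_{il}v_{jk}\text{ for all four distinct }i,j,k,l\in[n]\}$, with coordinates of $\mathbb{R}^{\binom n2}$ indexed by unordered pairs $\{i,j\}\subset[n]$ (so $v_{ij}=v_{ji}$). -}

module Defs where

open import Level using (Level; _⊔_; suc)
open import Data.Nat using (ℕ)
open import Data.Fin using (Fin)
open import Data.Product using (_×_)
open import Relation.Binary.PropositionalEquality using (_≢_)
open import Algebra.Bundles using (CommutativeRing)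
open import Relation.Binary.Structures using (IsTotalOrder)

record OrderedCommRing (c ℓ₁ ℓ₂ : Level) : Set (suc (c ⊔ ℓ₁ ⊔ ℓ₂)) where
  field
    commutativeRing : CommutativeRing c ℓ₁
  open CommutativeRing commutativeRing public
  field
    _≤_         : Carrier → Carrier → Set ℓ₂
    isTotalOrder : IsTotalOrder _≈_ _≤_
    +-mono-≤     : ∀ {x y} z → x ≤ y → (x + z) ≤ (y + z)
    *-nonneg     : ∀ {x y} → 0# ≤ x → 0# ≤ y → 0# ≤ (x * y)

Distinct4 : ∀ {n} → Fin n → Fin n → Fin n → Fin n → Set
Distinct4 i j k l = i ≢ j × i ≢ k × i ≢ l × j ≢ k × j ≢ l × k ≢ l

-- A vector indexed by unordered pairs {i,j} ⊂ [n] is represented as a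
-- symmetric function on ordered pairs of distinct indices (diagonal unused).
module _ {c ℓ₁ ℓ₂} (R : OrderedCommRing c ℓ₁ ℓ₂) where
  open OrderedCommRing R

  SymmetricVec : (n : ℕ) → (Fin n → Fin n → Carrier) → Set ℓ₁
  SymmetricVec n v = ∀ (i j : Fin n) → v i j ≈ v j i

  InP : (n : ℕ) → (Fin n → Fin n → Carrier) → Set (ℓ₂)
  InP n v =
    (∀ (i j : Fin n) → i ≢ j → 0# ≤ v i j) ×
    (∀ (i j k l : Fin n) → Distinct4 i j k l →
       (v i j * v k l) ≤ ((v i k * v j l) + (v i l * v j k)))

{-# OPTIONS --safe #-}
module Submission where

-- With v_ik = 0 the Ptolemy inequality for (i,j,k,l) loses its v_ik v_jl term and reads
-- v_ij v_kl ≤ v_il v_jk; the Ptolemy inequality for (i,l,k,j) gives the reverse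
-- inequality, so the two products are equal by antisymmetry.

open import Defs
open import Data.Nat using (ℕ)
open import Data.Fin using (Fin)
open import Data.Product using (_,_)
open import Relation.Binary.PropositionalEquality using (_≢_; ≢-sym)
open import Relation.Binary.Structures using (IsTotalOrder)

distinct4-swap₂₄ : ∀ {n} {i j k l : Fin n} → Distinct4 i j k l → Distinct4 i l k j
distinct4-swap₂₄ (i≢j , i≢k , i≢l , j≢k , j≢l , k≢l) =
  i≢l , i≢k , i≢j , ≢-sym k≢l , ≢-sym j≢l , ≢-sym j≢k

module _ {c ℓ₁ ℓ₂} (R : OrderedCommRing c ℓ₁ ℓ₂) where
  open OrderedCommRing R
  open IsTotalOrder isTotalOrder using (≤-respʳ-≈)

  zero*-+-identityˡ : ∀ {z} x y → z ≈ 0# → (z * x) + y ≈ y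
  zero*-+-identityˡ x y z≈0 =
    trans (+-cong (trans (*-cong z≈0 refl) (zeroˡ x)) refl) (+-identityˡ y)

  ptolemy-vanishing-diagonal : ∀ {n} (v : Fin n → Fin n → Carrier) → InP R n v →
    ∀ {i j k l} → Distinct4 i j k l → v i k ≈ 0# → (v i j * v k l) ≤ (v i l * v j k)
  ptolemy-vanishing-diagonal v (_ , ptolemy) {i} {j} {k} {l} d vik≈0 =
    ≤-respʳ-≈ (zero*-+-identityˡ (v j l) _ vik≈0) (ptolemy i j k l d)

lemma5p2 : ∀ {c ℓ₁ ℓ₂} (R : OrderedCommRing c ℓ₁ ℓ₂) (n : ℕ)
    (v : Fin n → Fin n → OrderedCommRing.Carrier R) →
    SymmetricVec R n v → InP R n v →
    (i k : Fin n) → i ≢ k → OrderedCommRing._≈_ R (v i k) (OrderedCommRing.0# R) →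
    (j l : Fin n) → Distinct4 i j k l →
    OrderedCommRing._≈_ R (OrderedCommRing._*_ R (v i j) (v k l))
    (OrderedCommRing._*_ R (v i l) (v j k))
lemma5p2 R n v symmetric inP i k _ vik≈0 j l d = antisym ≤-forward ≤-backward
  where
  open OrderedCommRing R
  open IsTotalOrder isTotalOrder using (antisym; ≤-respʳ-≈; ≤-respˡ-≈)

  ≤-forward : (v i j * v k l) ≤ (v i l * v j k)
  ≤-forward = ptolemy-vanishing-diagonal R v inP d vik≈0

  ≤-backward : (v i l * v j k) ≤ (v i j * v k l)
  ≤-backward =
    ≤-respˡ-≈ (*-cong refl (symmetric k j))
      (≤-respʳ-≈ (*-cong refl (symmetric l k))
        (ptolemy-vanishing-diagonal R v inP (distinct4-swap₂₄ d) vik≈0))
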